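{- For every finite relative simplicial complex $S$, $\mu_\infty(S)\equiv\chi(S)\pmod 2$. Likewise, if $S$ carries an $h$-tiling then $\mu'(S)\equiv\chi(S)\pmod 2$, and if $S$ carries a shellable $h$-tiling then $\mu(S)\equiv\chi(S)\pmod2$.
   Context: A finite relative simplicial complex $S=K\setminus L$ consists of a finite simplicial complex $K$ and a subcomplex $L$ containing no maximal simplex of $K$; $\chi(S)=\chi(K)-\chi(L)$. A basic tile of dimension $n$ and order $k\in\{0,\dots,n+1\}$ is an $n$-simplex deprived of $k$ of its $(n-1)$-faces; it has a unique face of least dimension $k-1$. A critical tile of index $k\in\{0,\dots,n\}$ is a basic tile of order $k$ deprived moreover of that face. An $h$-tiling of $S$ is a partition of $|K|\setminus|L|$ into basic or critical tiles with underlying simplices in $K$, such that for every $d\ge0$ the union of tiles of dimension $>d$ is closed; it is shellable if its tiles can be ordered so that every initial union is closed. $\mu'(S)$ (resp. $\mu(S)$) is the minimum over all $h$-tilings (resp. shellable $h$-tilings) of $S$ of the number of critical tiles used. $\mathrm{st}(S)$ denotes the relative complex obtained from $S$ by stellar subdivision at all its facets (maximal simplices of $K$), $\mathrm{st}^0(S)=S$, $\mathrm{st}^{d+1}(S)=\mathrm{st}(\mathrm{st}^d(S))$; $\mu_\infty(S)$ is the infimum of $\mu(\mathrm{st}^d(S))$ over all $d\ge0$ for which $\mathrm{st}^d(S)$ carries a shellable $h$-tiling (such $d$ exist). Stellar subdivision at a face $\tau$ of $K$: remove simplices containing $\tau$, add a vertex $\hat\tau$ and all cones $\hat\tau*\rho$,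 $\rho$ ranging over faces not containing $\tau$ of simplices containing $\tau$. -}

module Defs where

open import Data.Nat using (ℕ; zero; suc; _+_; _≤_; _<ᵇ_)
open import Data.Bool using (Bool; true; false; _∧_; _∨_; not; if_then_else_)
open import Data.Vec using (Vec; []; _∷_; take; drop)
open import Data.List using (List; []; _∷_; map; _++_; length; lookup)
open import Data.Bool.ListAction using (any; all)
import Data.List as L
open import Data.List.Relation.Unary.All using (All)
open import Data.Maybe using (Maybe; just; nothing)
import Data.Maybe as M
open import Data.Fin using (Fin)
import Data.Fin as F
open import Data.Integer using (ℤ; +_; -_; _-_)
import Data.Integer as Z
open import Data.Integer.Divisibility using (_∣_)
open import Data.Product using (Σ; _×_; _,_)
open import Relation.Binary.PropositionalEquality using (_≡_)

-- Simplices on the vertex set Fin N are subsets, encoded as Vec Bool N.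

Simplex : ℕ → Set
Simplex N = Vec Bool N

allSubsets : (n : ℕ) → List (Simplex n)
allSubsets zero    = [] ∷ []
allSubsets (suc n) = map (false ∷_) (allSubsets n) ++ map (true ∷_) (allSubsets n)

_⊆ᵇ_ : ∀ {n} → Simplex n → Simplex n → Bool
[]       ⊆ᵇ []       = true
(x ∷ xs) ⊆ᵇ (y ∷ ys) = (not x ∨ y) ∧ (xs ⊆ᵇ ys)

_≡ᵇ_ : ∀ {n} → Simplex n → Simplex n → Bool
a ≡ᵇ b = (a ⊆ᵇ b) ∧ (b ⊆ᵇ a)

_⊂ᵇ_ : ∀ {n} → Simplex n → Simplex n → Bool
a ⊂ᵇ b = (a ⊆ᵇ b) ∧ not (b ⊆ᵇ a)

nonempty : ∀ {n} → Simplex n → Bool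
nonempty []       = false
nonempty (x ∷ xs) = x ∨ nonempty xs

-- number of vertices (= dimension + 1)
size : ∀ {n} → Simplex n → ℕ
size []           = zero
size (true ∷ xs)  = suc (size xs)
size (false ∷ xs) = size xs

boolEq : Bool → Bool → Bool
boolEq true  b = b
boolEq false b = not b

filterB : {A : Set} → (A → Bool) → List A → List A
filterB p []       = []
filterB p (x ∷ xs) = if p x then x ∷ filterB p xs else filterB p xs

countB : {A : Set} → (A → Bool) → List A → ℕ
countB p xs = length (filterB p xs)

-- Raw relative simplicial complexes S = K \ L on vertex set Fin N.
-- K and L are (decidable, hence finite) sets of nonempty simplices.

record RelCx : Set where
  field
    N : ℕ
    K : Simplex N → Bool
    L : Simplex N → Bool
open RelCx public

isFacet : ∀ {n} → (Simplex n → Bool) → Simplex n → Bool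
isFacet {n} K σ = K σ ∧ not (any (λ τ → K τ ∧ (σ ⊂ᵇ τ)) (allSubsets n))

record IsRelComplex (S : RelCx) : Set where
  field
    K-nonempty : ∀ σ → K S σ ≡ true → nonempty σ ≡ true
    K-closed   : ∀ σ ρ → K S σ ≡ true → (ρ ⊆ᵇ σ) ≡ true → nonempty ρ ≡ true → K S ρ ≡ true
    L⊆K        : ∀ σ → L S σ ≡ true → K S σ ≡ true
    L-closed   : ∀ σ ρ → L S σ ≡ true → (ρ ⊆ᵇ σ) ≡ true → nonempty ρ ≡ true → L S ρ ≡ true
    L-nofacet  : ∀ σ → isFacet (K S) σ ≡ true → L S σ ≡ false

-- faces of |K| \ |L| (open simplices)
inS : (S : RelCx) → Simplex (N S) → Bool
inS S ρ = nonempty ρ ∧ K S ρ ∧ not (L S ρ)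

alt : ℕ → ℤ
alt zero    = + 1
alt (suc k) = - alt k

-- (-1)^(dim ρ), dim ρ = size ρ - 1
sgnDim : ℕ → ℤ
sgnDim zero    = + 0
sgnDim (suc k) = alt k

sumℤ : List ℤ → ℤ
sumℤ []       = + 0
sumℤ (x ∷ xs) = x Z.+ sumℤ xs

-- χ(S) = χ(K) - χ(L) = Σ_{ρ ∈ K \ L} (-1)^dim ρ
chi : RelCx → ℤ
chi S = sumℤ (map (λ ρ → if inS S ρ then sgnDim (size ρ) else + 0) (allSubsets (N S)))

ParityEq : ℕ → ℤ → Set
ParityEq m z = (+ 2) ∣ ((+ m) - z)

-- A tile with underlying simplex σ and least face τ ⊆ σ:
--  * basic (crit = false): σ deprived of the |τ| facets not containing τ,
--    i.e. the union of the open faces ρ with τ ⊆ ρ ⊆ σ (order |τ|);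
--  * critical (crit = true, τ ⊊ σ): moreover deprived of the face τ,
--    i.e. the union of open faces ρ with τ ⊊ ρ ⊆ σ (index |τ|).
-- As a point set, a tile is the union of the (nonempty) open faces it contains.

record Tile (n : ℕ) : Set where
  constructor tile
  field
    top  : Simplex n
    low  : Simplex n
    crit : Bool
open Tile public

inTile : ∀ {n} → Tile n → Simplex n → Bool
inTile t ρ = nonempty ρ ∧ (low t ⊆ᵇ ρ) ∧ (ρ ⊆ᵇ top t)
             ∧ (if crit t then not (ρ ≡ᵇ low t) else true)

record ValidTile (S : RelCx) (t : Tile (N S)) : Set where
  field
    top∈K   : K S (top t) ≡ true
    low⊆top : (low t ⊆ᵇ top t) ≡ true
    critIdx : crit t ≡ true → (low t ⊂ᵇ top t) ≡ true

-- the point set of t is a critical tile (of some index, on some simplex)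
isCriticalTile : ∀ {n} → Tile n → Bool
isCriticalTile {n} t =
  any (λ σ → any (λ τ → (τ ⊂ᵇ σ) ∧
         all (λ ρ → boolEq (inTile t ρ) (inTile (tile σ τ true) ρ)) (allSubsets n))
       (allSubsets n)) (allSubsets n)

numCrit : ∀ {n} → List (Tile n) → ℕ
numCrit T = countB isCriticalTile T

union : ∀ {n} → List (Tile n) → Simplex n → Bool
union T ρ = any (λ t → inTile t ρ) T

ClosedIn : (S : RelCx) → (Simplex (N S) → Bool) → Set
ClosedIn S U = ∀ ρ ρ' → U ρ ≡ true → (ρ' ⊆ᵇ ρ) ≡ true → nonempty ρ' ≡ true
             → L S ρ' ≡ false → U ρ' ≡ true

-- tiles of dimension > d  (dim = size - 1)
dimAbove : ∀ {n} → ℕ → Tile n → Bool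
dimAbove d t = suc d <ᵇ size (top t)

record HTiling (S : RelCx) (T : List (Tile (N S))) : Set where
  field
    valid     : All (ValidTile S) T
    partition : ∀ ρ → countB (λ t → inTile t ρ) T ≡ (if inS S ρ then 1 else 0)
    filtered  : ∀ d → ClosedIn S (union (filterB (dimAbove d) T))

-- shellable: the list order is a shelling order
record ShellableHTiling (S : RelCx) (T : List (Tile (N S))) : Set where
  field
    htiling : HTiling S T
    shell   : ∀ k → ClosedIn S (union (L.take k T))

IsMuPrime : RelCx → ℕ → Set
IsMuPrime S m = (Σ (List (Tile (N S))) λ T → HTiling S T × numCrit T ≡ m)
              × (∀ T → HTiling S T → m ≤ numCrit T)

IsMu : RelCx → ℕ → Set
IsMu S m = (Σ (List (Tile (N S))) λ T → ShellableHTiling S T × numCrit T ≡ m)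
         × (∀ T → ShellableHTiling S T → m ≤ numCrit T)

-- Stellar subdivision at all facets.  New vertex set Fin (N + F), where
-- the F = #facets new vertices are indexed by the list of facets.

facetsList : (S : RelCx) → List (Simplex (N S))
facetsList S = filterB (isFacet (K S)) (allSubsets (N S))

singletonIdx : ∀ {n} → Vec Bool n → Maybe (Fin n)
singletonIdx []           = nothing
singletonIdx (true ∷ xs)  = if nonempty xs then nothing else just F.zero
singletonIdx (false ∷ xs) = M.map F.suc (singletonIdx xs)

st : RelCx → RelCx
st S = record { N = N S + length fl ; K = K' ; L = L' }
  where
  fl = facetsList S
  K' : Simplex (N S + length fl) → Bool
  K' σ with singletonIdx (drop (N S) σ)
  ... | just j  = take (N S) σ ⊂ᵇ lookup fl j
  ... | nothing = not (nonempty (drop (N S) σ))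
                  ∧ K S (take (N S) σ) ∧ not (isFacet (K S) (take (N S) σ))
  L' : Simplex (N S + length fl) → Bool
  L' σ = not (nonempty (drop (N S) σ)) ∧ L S (take (N S) σ)

stIter : ℕ → RelCx → RelCx
stIter zero    S = S
stIter (suc d) S = st (stIter d S)

IsMuInf : RelCx → ℕ → Set
IsMuInf S m = (Σ ℕ λ d → Σ (List (Tile (N (stIter d S)))) λ T →
                 ShellableHTiling (stIter d S) T × numCrit T ≡ m)
            × (∀ d T → ShellableHTiling (stIter d S) T → m ≤ numCrit T)

-- Mod 2, χ(S) is the number of open faces of S.  A tile with underlying simplex σ and least
-- face τ consists of the nonempty faces of the Boolean interval [τ, σ], minus τ itself when
-- it is critical.  As an interval of length k has 2^k elements, a tile has an odd number of
-- faces exactly when it is critical as a point set (the closed simplex, τ = ∅, and the open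
-- simplex, τ = σ, are critical tiles in disguise).  Hence every h-tiling has ≡ χ(S) critical
-- tiles mod 2.  For μ∞ it remains to see that stellar subdivision at the facets preserves
-- χ mod 2: each facet σ (never a face of L) is traded for the 2^|σ| - 1 cones over its
-- proper faces.

module Submission where

open import Defs
open import Data.Nat using (ℕ; zero; suc; _+_; _≤_; _<_; z≤n; s≤s)
open import Data.Nat.Properties using (≤-trans; ≤⇒≯; m≤n⇒m≤1+n; m≤n+m; +-suc; +-identityʳ; +-monoˡ-≤)
open import Data.Empty using (⊥-elim)
open import Data.Bool using (Bool; true; false; _∧_; _∨_; not; if_then_else_; _xor_; T)
open import Data.Bool.Properties
  using (∧-assoc; ∧-comm; ∧-conicalˡ; ∧-conicalʳ; ∨-zeroʳ; ∧-zeroʳ; ∧-identityʳ; ∧-distribˡ-xor;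
         not-involutive; not-injective; true-xor;
         xor-assoc; xor-comm; xor-same; xor-identityʳ; xor-∧-commutativeRing; T-≡; ⇔→≡)
open import Data.Bool.ListAction using (any; all)
open import Data.Vec using ([]; _∷_; replicate; take; drop) renaming (_++_ to _++ᵛ_)
open import Data.Vec.Properties using (take++drop≡id)
open import Data.Fin using (Fin)
import Data.Fin as Fin
open import Data.Maybe using (Maybe; just; nothing)
import Data.Maybe as Maybe
open import Data.List using (List; []; _∷_; map; _++_; length; lookup; allFin)
open import Data.List.Properties using (map-tabulate; tabulate-lookup)
open import Data.List.Relation.Unary.All using (All; []; _∷_)
import Data.List.Relation.Unary.All as All
open import Data.List.Relation.Unary.All.Properties using (all⁺; all⁻)
open import Data.List.Relation.Unary.Any using (here; there; satisfied)
import Data.List.Relation.Unary.Any as Any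
open import Data.List.Relation.Unary.Any.Properties using (any⁺; any⁻; lookup-index)
open import Data.List.Membership.Propositional using (_∈_)
open import Data.List.Membership.Propositional.Properties using (∈-++⁺ˡ; ∈-++⁺ʳ; ∈-map⁺)
open import Data.Product using (Σ; ∃; _×_; _,_; proj₁; proj₂)
import Data.Product as Product
open import Algebra.Bundles using (CommutativeRing)
open import Algebra.Properties.CommutativeSemigroup
  (CommutativeRing.+-commutativeSemigroup xor-∧-commutativeRing)
  using () renaming (interchange to xor-interchange)
open import Data.Integer using (ℤ; +_; -_; _-_; _*_) renaming (_+_ to _+ℤ_)
open import Data.Integer.Properties using (+-identityˡ)
open import Data.Integer.Divisibility.Signed using (_∣_; divides; ∣-refl; ∣m∣n⇒∣m+n; ∣m⇒∣-m; ∣m⇒∣m*n; ∣⇒∣ᵤ)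
open import Data.Integer.Tactic.RingSolver using (solve-∀)
open import Function.Base using (case_of_)
open import Function.Bundles using (Equivalence; mk⇔)
open import Relation.Binary.PropositionalEquality
  using (_≡_; refl; sym; trans; cong; cong₂; subst; subst₂; module ≡-Reasoning)

private variable
  A B : Set

isOdd : ℕ → Bool
isOdd zero    = false
isOdd (suc n) = not (isOdd n)

oddCount : (A → Bool) → List A → Bool
oddCount p []       = false
oddCount p (x ∷ xs) = p x xor oddCount p xs

isOdd-countB : ∀ (p : A → Bool) xs → isOdd (countB p xs) ≡ oddCount p xs
isOdd-countB p [] = refl
isOdd-countB p (x ∷ xs) with p x
... | true  = cong not (isOdd-countB p xs)
... | false = isOdd-countB p xs

oddCount-cong : {f g : A → Bool} → (∀ x → f x ≡ g x) → ∀ xs → oddCount f xs ≡ oddCount g xs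
oddCount-cong f≗g []       = refl
oddCount-cong f≗g (x ∷ xs) = cong₂ _xor_ (f≗g x) (oddCount-cong f≗g xs)

oddCount-cong-All : {f g : A → Bool} {xs : List A} → All (λ x → f x ≡ g x) xs → oddCount f xs ≡ oddCount g xs
oddCount-cong-All []       = refl
oddCount-cong-All (e ∷ es) = cong₂ _xor_ e (oddCount-cong-All es)

oddCount-false : ∀ (xs : List A) → oddCount (λ _ → false) xs ≡ false
oddCount-false []       = refl
oddCount-false (x ∷ xs) = oddCount-false xs

oddCount-∧-false : ∀ (f : A → Bool) xs → oddCount (λ x → f x ∧ false) xs ≡ false
oddCount-∧-false f xs = trans (oddCount-cong (λ x → ∧-zeroʳ (f x)) xs) (oddCount-false xs)

oddCount-++ : ∀ (f : A → Bool) xs ys → oddCount f (xs ++ ys) ≡ oddCount f xs xor oddCount f ys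
oddCount-++ f []       ys = refl
oddCount-++ f (x ∷ xs) ys = trans (cong (f x xor_) (oddCount-++ f xs ys)) (sym (xor-assoc (f x) _ _))

oddCount-map : ∀ (f : B → Bool) (h : A → B) xs → oddCount f (map h xs) ≡ oddCount (λ x → f (h x)) xs
oddCount-map f h []       = refl
oddCount-map f h (x ∷ xs) = cong (f (h x) xor_) (oddCount-map f h xs)

oddCount-xor : ∀ (f g : A → Bool) xs → oddCount (λ x → f x xor g x) xs ≡ oddCount f xs xor oddCount g xs
oddCount-xor f g []       = refl
oddCount-xor f g (x ∷ xs) =
  trans (cong ((f x xor g x) xor_) (oddCount-xor f g xs)) (xor-interchange (f x) (g x) _ _)

oddCount-swap : ∀ (h : A → B → Bool) xs ys →
                oddCount (λ x → oddCount (h x) ys) xs ≡ oddCount (λ y → oddCount (λ x → h x y) xs) ys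
oddCount-swap h []       ys = sym (oddCount-false ys)
oddCount-swap h (x ∷ xs) ys = trans (cong (oddCount (h x) ys xor_) (oddCount-swap h xs ys))
                                    (sym (oddCount-xor (h x) (λ y → oddCount (λ x → h x y) xs) ys))

oddCount-filterB : ∀ (p f : A → Bool) xs → oddCount f (filterB p xs) ≡ oddCount (λ x → p x ∧ f x) xs
oddCount-filterB p f []       = refl
oddCount-filterB p f (x ∷ xs) with p x
... | true  = cong (f x xor_) (oddCount-filterB p f xs)
... | false = oddCount-filterB p f xs

any-witness : ∀ (p : A → Bool) xs → any p xs ≡ true → ∃ λ x → p x ≡ true
any-witness p xs e = Product.map₂ (Equivalence.to T-≡) (satisfied (any⁻ p xs (Equivalence.from T-≡ e)))

any-intro : ∀ (p : A → Bool) {x xs} → x ∈ xs → p x ≡ true → any p xs ≡ true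
any-intro p x∈xs px = Equivalence.to T-≡ (any⁺ p (Any.map (λ { refl → Equivalence.from T-≡ px }) x∈xs))

boolEq-sound : ∀ a b → T (boolEq a b) → a ≡ b
boolEq-sound true  true  _ = refl
boolEq-sound false false _ = refl

boolEq-refl : ∀ b → boolEq b b ≡ true
boolEq-refl true  = refl
boolEq-refl false = refl

oddCount-cong-boolEq : ∀ {f g : A → Bool} xs → all (λ x → boolEq (f x) (g x)) xs ≡ true → oddCount f xs ≡ oddCount g xs
oddCount-cong-boolEq {f = f} {g} xs e =
  oddCount-cong-All (All.map (boolEq-sound _ _) (all⁺ (λ x → boolEq (f x) (g x)) xs (Equivalence.from T-≡ e)))

all-intro : ∀ (p : A → Bool) → (∀ x → p x ≡ true) → ∀ xs → all p xs ≡ true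
all-intro p h xs = Equivalence.to T-≡ (all⁻ p (All.universal (λ x → Equivalence.from T-≡ (h x)) xs))

∅ : ∀ {n} → Simplex n
∅ = replicate _ false

⊆-refl : ∀ {n} (a : Simplex n) → (a ⊆ᵇ a) ≡ true
⊆-refl []          = refl
⊆-refl (true ∷ a)  = ⊆-refl a
⊆-refl (false ∷ a) = ⊆-refl a

⊆-trans : ∀ {n} {a b c : Simplex n} → (a ⊆ᵇ b) ≡ true → (b ⊆ᵇ c) ≡ true → (a ⊆ᵇ c) ≡ true
⊆-trans {a = []}        {[]}        {[]}        _  _  = refl
⊆-trans {a = true ∷ a}  {true ∷ b}  {true ∷ c}  ab bc = ⊆-trans {a = a} ab bc
⊆-trans {a = false ∷ a} {true ∷ b}  {true ∷ c}  ab bc = ⊆-trans {a = a} ab bc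
⊆-trans {a = false ∷ a} {false ∷ b} {true ∷ c}  ab bc = ⊆-trans {a = a} ab bc
⊆-trans {a = false ∷ a} {false ∷ b} {false ∷ c} ab bc = ⊆-trans {a = a} ab bc
⊆-trans {a = false ∷ a} {true ∷ b}  {false ∷ c} _  ()
⊆-trans {a = true ∷ a}  {false ∷ b}             ()
⊆-trans {a = true ∷ a}  {true ∷ b}  {false ∷ c} _  ()

∅⊆ : ∀ {n} (a : Simplex n) → (∅ ⊆ᵇ a) ≡ true
∅⊆ []      = refl
∅⊆ (_ ∷ a) = ∅⊆ a

⊆∅ : ∀ {n} (a : Simplex n) → (a ⊆ᵇ ∅) ≡ not (nonempty a)
⊆∅ []          = refl
⊆∅ (true ∷ a)  = refl
⊆∅ (false ∷ a) = ⊆∅ a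

≡ᵇ∅ : ∀ {n} (a : Simplex n) → (a ≡ᵇ ∅) ≡ not (nonempty a)
≡ᵇ∅ a rewrite ⊆∅ a | ∅⊆ a = ∧-identityʳ _

nonempty-≡ᵇ∅ : ∀ {n} (a : Simplex n) → nonempty a ≡ not (a ≡ᵇ ∅)
nonempty-≡ᵇ∅ a = trans (sym (not-involutive _)) (cong not (sym (≡ᵇ∅ a)))

∅≡ᵇ : ∀ {n} (a : Simplex n) → (∅ ≡ᵇ a) ≡ not (nonempty a)
∅≡ᵇ a = cong₂ _∧_ (∅⊆ a) (⊆∅ a)

nonempty-∅ : ∀ {n} → nonempty (∅ {n}) ≡ false
nonempty-∅ {zero}  = refl
nonempty-∅ {suc n} = nonempty-∅ {n}

empty⇒≡∅ : ∀ {n} (a : Simplex n) → nonempty a ≡ false → a ≡ ∅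
empty⇒≡∅ []          _ = refl
empty⇒≡∅ (false ∷ a) e = cong (false ∷_) (empty⇒≡∅ a e)

≡ᵇ⇒≡ : ∀ {n} (a b : Simplex n) → (a ≡ᵇ b) ≡ true → a ≡ b
≡ᵇ⇒≡ []          []          _ = refl
≡ᵇ⇒≡ (true ∷ a)  (true ∷ b)  e = cong (true ∷_) (≡ᵇ⇒≡ a b e)
≡ᵇ⇒≡ (false ∷ a) (false ∷ b) e = cong (false ∷_) (≡ᵇ⇒≡ a b e)
≡ᵇ⇒≡ (false ∷ a) (true ∷ b)  e with () ← trans (sym (∧-zeroʳ (a ⊆ᵇ b))) e

∈-allSubsets : ∀ {n} (a : Simplex n) → a ∈ allSubsets n
∈-allSubsets []                = here refl
∈-allSubsets {suc n} (false ∷ a) = ∈-++⁺ˡ (∈-map⁺ (false ∷_) (∈-allSubsets a))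
∈-allSubsets {suc n} (true ∷ a)  = ∈-++⁺ʳ (map (false ∷_) (allSubsets n)) (∈-map⁺ (true ∷_) (∈-allSubsets a))

oddCount-allSubsets-suc : ∀ n (f : Simplex (suc n) → Bool) →
  oddCount f (allSubsets (suc n))
  ≡ oddCount (λ a → f (false ∷ a)) (allSubsets n) xor oddCount (λ a → f (true ∷ a)) (allSubsets n)
oddCount-allSubsets-suc n f =
  trans (oddCount-++ f (map (false ∷_) (allSubsets n)) _)
        (cong₂ _xor_ (oddCount-map f (false ∷_) (allSubsets n)) (oddCount-map f (true ∷_) (allSubsets n)))

oddCount-at : ∀ n (f : Simplex n → Bool) c → oddCount (λ a → f a ∧ (a ≡ᵇ c)) (allSubsets n) ≡ f c
oddCount-at zero    f []      = trans (xor-identityʳ _) (∧-identityʳ (f []))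
oddCount-at (suc n) f (x ∷ c) = trans (oddCount-allSubsets-suc n _) (split x)
  where
  split : ∀ x → oddCount (λ a → f (false ∷ a) ∧ ((false ∷ a) ≡ᵇ (x ∷ c))) (allSubsets n)
                xor oddCount (λ a → f (true ∷ a) ∧ ((true ∷ a) ≡ᵇ (x ∷ c))) (allSubsets n)
                ≡ f (x ∷ c)
  split false = trans (cong₂ _xor_ (oddCount-at n (λ a → f (false ∷ a)) c)
                                    (oddCount-∧-false (λ a → f (true ∷ a)) (allSubsets n)))
                      (xor-identityʳ _)
  split true  = trans (cong (_xor oddCount (λ a → f (true ∷ a) ∧ (a ≡ᵇ c)) (allSubsets n))
                            (trans (oddCount-cong (λ a → cong (f (false ∷ a) ∧_) (∧-zeroʳ (a ⊆ᵇ c))) (allSubsets n))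
                                   (oddCount-∧-false (λ a → f (false ∷ a)) (allSubsets n))))
                      (oddCount-at n (λ a → f (true ∷ a)) c)

oddCount-delete : ∀ n (f : Simplex n → Bool) c →
  oddCount (λ a → f a ∧ not (a ≡ᵇ c)) (allSubsets n) ≡ oddCount f (allSubsets n) xor f c
oddCount-delete n f c = begin
  oddCount (λ a → f a ∧ not (a ≡ᵇ c)) (allSubsets n)
    ≡⟨ oddCount-cong (λ a → ∧-not-as-xor (f a) (a ≡ᵇ c)) (allSubsets n) ⟩
  oddCount (λ a → f a xor (f a ∧ (a ≡ᵇ c))) (allSubsets n)
    ≡⟨ oddCount-xor f _ (allSubsets n) ⟩
  oddCount f (allSubsets n) xor oddCount (λ a → f a ∧ (a ≡ᵇ c)) (allSubsets n)
    ≡⟨ cong (oddCount f (allSubsets n) xor_) (oddCount-at n f c) ⟩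
  oddCount f (allSubsets n) xor f c ∎
  where
  open ≡-Reasoning
  ∧-not-as-xor : ∀ x y → x ∧ not y ≡ x xor (x ∧ y)
  ∧-not-as-xor x y = trans (cong (x ∧_) (sym (true-xor y)))
                           (trans (∧-distribˡ-xor x true y) (cong (_xor (x ∧ y)) (∧-identityʳ x)))

oddCount-empty : ∀ n c → oddCount (λ (b : Simplex n) → not (nonempty b) ∧ c) (allSubsets n) ≡ c
oddCount-empty n c =
  trans (oddCount-cong (λ b → trans (∧-comm (not (nonempty b)) c) (cong (c ∧_) (sym (≡ᵇ∅ b)))) (allSubsets n))
        (oddCount-at n (λ _ → c) ∅)

-- The faces between τ and σ form a Boolean lattice, of odd size only when it is a point.
oddCount-interval : ∀ n (τ σ : Simplex n) → oddCount (λ a → (τ ⊆ᵇ a) ∧ (a ⊆ᵇ σ)) (allSubsets n) ≡ (τ ≡ᵇ σ)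
oddCount-interval zero    []      []      = refl
oddCount-interval (suc n) (x ∷ τ) (y ∷ σ) = trans (oddCount-allSubsets-suc n _) (split x y)
  where
  ih = oddCount-interval n τ σ
  noFaces = oddCount-∧-false (τ ⊆ᵇ_) (allSubsets n)
  split : ∀ x y → oddCount (λ a → ((x ∷ τ) ⊆ᵇ (false ∷ a)) ∧ ((false ∷ a) ⊆ᵇ (y ∷ σ))) (allSubsets n)
                  xor oddCount (λ a → ((x ∷ τ) ⊆ᵇ (true ∷ a)) ∧ ((true ∷ a) ⊆ᵇ (y ∷ σ))) (allSubsets n)
                  ≡ ((x ∷ τ) ≡ᵇ (y ∷ σ))
  split false false = trans (cong₂ _xor_ ih noFaces) (xor-identityʳ _)
  split false true  = trans (cong₂ _xor_ ih ih) (trans (xor-same (τ ≡ᵇ σ)) (sym (∧-zeroʳ (τ ⊆ᵇ σ))))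
  split true  false = cong₂ _xor_ (oddCount-false (allSubsets n)) noFaces
  split true  true  = cong₂ _xor_ (oddCount-false (allSubsets n)) ih

oddCount-⊂ᵇ : ∀ n (σ : Simplex n) → oddCount (_⊂ᵇ σ) (allSubsets n) ≡ nonempty σ
oddCount-⊂ᵇ n σ = begin
  oddCount (_⊂ᵇ σ) (allSubsets n)
    ≡⟨ oddCount-cong (λ a → strict (a ⊆ᵇ σ) (σ ⊆ᵇ a)) (allSubsets n) ⟩
  oddCount (λ a → (a ⊆ᵇ σ) ∧ not (a ≡ᵇ σ)) (allSubsets n)
    ≡⟨ oddCount-delete n (_⊆ᵇ σ) σ ⟩
  oddCount (_⊆ᵇ σ) (allSubsets n) xor (σ ⊆ᵇ σ)
    ≡⟨ cong₂ _xor_ (trans (oddCount-cong (λ a → cong (_∧ (a ⊆ᵇ σ)) (sym (∅⊆ a))) (allSubsets n))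
                          (oddCount-interval n ∅ σ))
                   (⊆-refl σ) ⟩
  (∅ ≡ᵇ σ) xor true
    ≡⟨ cong (_xor true) (∅≡ᵇ σ) ⟩
  not (nonempty σ) xor true
    ≡⟨ trans (xor-comm _ true) (trans (true-xor _) (not-involutive _)) ⟩
  nonempty σ ∎
  where
  open ≡-Reasoning
  strict : ∀ x y → x ∧ not y ≡ x ∧ not (x ∧ y)
  strict true  y = refl
  strict false y = refl

oddFaces : ∀ {n} → (Simplex n → Bool) → Bool
oddFaces {n} U = oddCount U (allSubsets n)

inTile-interval : ∀ {n} σ τ c (ρ : Simplex n) →
  inTile (tile σ τ c) ρ ≡ (((τ ⊆ᵇ ρ) ∧ (ρ ⊆ᵇ σ)) ∧ not (ρ ≡ᵇ ∅)) ∧ (if c then not (ρ ≡ᵇ τ) else true)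
inTile-interval σ τ c ρ = begin
  nonempty ρ ∧ (a ∧ (b ∧ d))  ≡⟨ cong (nonempty ρ ∧_) (sym (∧-assoc a b d)) ⟩
  nonempty ρ ∧ ((a ∧ b) ∧ d)  ≡⟨ sym (∧-assoc (nonempty ρ) (a ∧ b) d) ⟩
  (nonempty ρ ∧ (a ∧ b)) ∧ d  ≡⟨ cong (_∧ d) (∧-comm (nonempty ρ) (a ∧ b)) ⟩
  ((a ∧ b) ∧ nonempty ρ) ∧ d  ≡⟨ cong (λ x → ((a ∧ b) ∧ x) ∧ d) (nonempty-≡ᵇ∅ ρ) ⟩
  ((a ∧ b) ∧ not (ρ ≡ᵇ ∅)) ∧ d ∎
  where
  open ≡-Reasoning
  a = τ ⊆ᵇ ρ
  b = ρ ⊆ᵇ σ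
  d = if c then not (ρ ≡ᵇ τ) else true

oddFaces-nonemptyInterval : ∀ {n} (σ τ : Simplex n) →
  oddFaces (λ ρ → ((τ ⊆ᵇ ρ) ∧ (ρ ⊆ᵇ σ)) ∧ not (ρ ≡ᵇ ∅)) ≡ (τ ≡ᵇ σ) xor not (nonempty τ)
oddFaces-nonemptyInterval {n} σ τ =
  trans (oddCount-delete n (λ ρ → (τ ⊆ᵇ ρ) ∧ (ρ ⊆ᵇ σ)) ∅)
        (cong₂ _xor_ (oddCount-interval n τ σ) (trans (cong₂ _∧_ (⊆∅ τ) (∅⊆ σ)) (∧-identityʳ _)))

oddFaces-basic : ∀ {n} (σ τ : Simplex n) → oddFaces (inTile (tile σ τ false)) ≡ (τ ≡ᵇ σ) xor not (nonempty τ)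
oddFaces-basic σ τ =
  trans (oddCount-cong (λ ρ → trans (inTile-interval σ τ false ρ) (∧-identityʳ _)) (allSubsets _))
        (oddFaces-nonemptyInterval σ τ)

oddFaces-critical : ∀ {n} (σ τ : Simplex n) → (τ ⊂ᵇ σ) ≡ true → oddFaces (inTile (tile σ τ true)) ≡ true
oddFaces-critical {n} σ τ τ⊂σ = begin
  oddFaces (inTile (tile σ τ true))
    ≡⟨ oddCount-cong (inTile-interval σ τ true) (allSubsets n) ⟩
  oddFaces (λ ρ → J ρ ∧ not (ρ ≡ᵇ τ))
    ≡⟨ oddCount-delete n J τ ⟩
  oddFaces J xor J τ
    ≡⟨ cong₂ _xor_ (oddFaces-nonemptyInterval σ τ) (cong (λ x → (x ∧ (τ ⊆ᵇ σ)) ∧ not (τ ≡ᵇ ∅)) (⊆-refl τ)) ⟩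
  ((τ ≡ᵇ σ) xor not (nonempty τ)) xor ((τ ⊆ᵇ σ) ∧ not (τ ≡ᵇ ∅))
    ≡⟨ cong (λ x → ((τ ≡ᵇ σ) xor not (nonempty τ)) xor ((τ ⊆ᵇ σ) ∧ x)) (sym (nonempty-≡ᵇ∅ τ)) ⟩
  ((τ ≡ᵇ σ) xor not (nonempty τ)) xor ((τ ⊆ᵇ σ) ∧ nonempty τ)
    ≡⟨ strictlyInside (τ ⊆ᵇ σ) (σ ⊆ᵇ τ) (nonempty τ) τ⊂σ ⟩
  true ∎
  where
  open ≡-Reasoning
  J : Simplex n → Bool
  J ρ = ((τ ⊆ᵇ ρ) ∧ (ρ ⊆ᵇ σ)) ∧ not (ρ ≡ᵇ ∅)
  strictlyInside : ∀ x y e → x ∧ not y ≡ true → ((x ∧ y) xor not e) xor (x ∧ e) ≡ true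
  strictlyInside true false true  _ = refl
  strictlyInside true false false _ = refl

isCriticalTile-intro : ∀ {n} (t : Tile n) σ τ → (τ ⊂ᵇ σ) ≡ true →
  (∀ ρ → inTile t ρ ≡ inTile (tile σ τ true) ρ) → isCriticalTile t ≡ true
isCriticalTile-intro {n} t σ τ τ⊂σ same =
  any-intro _ (∈-allSubsets σ) (any-intro _ (∈-allSubsets τ)
    (cong₂ _∧_ τ⊂σ (all-intro _ sameFaces (allSubsets n))))
  where
  sameFaces : ∀ ρ → boolEq (inTile t ρ) (inTile (tile σ τ true) ρ) ≡ true
  sameFaces ρ = trans (cong (λ x → boolEq x _) (same ρ)) (boolEq-refl (inTile (tile σ τ true) ρ))

isCriticalTile⇒oddFaces : ∀ {n} (t : Tile n) → isCriticalTile t ≡ true → oddFaces (inTile t) ≡ true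
isCriticalTile⇒oddFaces {n} t crit-t with any-witness _ (allSubsets n) crit-t
... | σ , ∃τ with any-witness _ (allSubsets n) ∃τ
... | τ , e = trans (oddCount-cong-boolEq (allSubsets n) (∧-conicalʳ (τ ⊂ᵇ σ) _ e))
                    (oddFaces-critical σ τ (∧-conicalˡ (τ ⊂ᵇ σ) _ e))

dropFirstVertex : ∀ {n} → Simplex n → Simplex n
dropFirstVertex []          = []
dropFirstVertex (true ∷ a)  = false ∷ a
dropFirstVertex (false ∷ a) = false ∷ dropFirstVertex a

dropFirstVertex-⊂ : ∀ {n} (σ : Simplex n) → nonempty σ ≡ true → (dropFirstVertex σ ⊂ᵇ σ) ≡ true
dropFirstVertex-⊂ (true ∷ σ)  _ rewrite ⊆-refl σ = refl
dropFirstVertex-⊂ (false ∷ σ) e = dropFirstVertex-⊂ σ e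

-- Between σ minus a vertex and σ there are exactly two faces, so deleting the lower one leaves σ alone.
dropFirstVertex-interval : ∀ {n} (σ : Simplex n) → nonempty σ ≡ true → ∀ ρ →
  (σ ⊆ᵇ ρ) ∧ ((ρ ⊆ᵇ σ) ∧ true) ≡ (dropFirstVertex σ ⊆ᵇ ρ) ∧ ((ρ ⊆ᵇ σ) ∧ not (ρ ≡ᵇ dropFirstVertex σ))
dropFirstVertex-interval (true ∷ σ)  _ (x ∷ ρ) = headCases x (σ ⊆ᵇ ρ) (ρ ⊆ᵇ σ)
  where
  headCases : ∀ x y z → ((not true ∨ x) ∧ y) ∧ (((not x ∨ true) ∧ z) ∧ true)
                    ≡ ((not false ∨ x) ∧ y) ∧ (((not x ∨ true) ∧ z) ∧ not (((not x ∨ false) ∧ z) ∧ ((not false ∨ x) ∧ y)))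
  headCases true  true  true  = refl
  headCases true  true  false = refl
  headCases true  false z     = refl
  headCases false true  true  = refl
  headCases false true  false = refl
  headCases false false z     = refl
dropFirstVertex-interval (false ∷ σ) e (false ∷ ρ) = dropFirstVertex-interval σ e ρ
dropFirstVertex-interval (false ∷ σ) e (true ∷ ρ)
  rewrite ∧-zeroʳ (σ ⊆ᵇ ρ) | ∧-zeroʳ (dropFirstVertex σ ⊆ᵇ ρ) = refl

openSimplex-critical : ∀ {n} (σ : Simplex n) → nonempty σ ≡ true → isCriticalTile (tile σ σ false) ≡ true
openSimplex-critical σ e = isCriticalTile-intro (tile σ σ false) σ (dropFirstVertex σ) (dropFirstVertex-⊂ σ e)
  (λ ρ → cong (nonempty ρ ∧_) (dropFirstVertex-interval σ e ρ))

closedSimplex-critical : ∀ {n} (σ : Simplex n) → nonempty σ ≡ true → isCriticalTile (tile σ ∅ false) ≡ true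
closedSimplex-critical σ e = isCriticalTile-intro (tile σ ∅ false) σ ∅ ∅⊂σ same
  where
  ∅⊂σ : (∅ ⊂ᵇ σ) ≡ true
  ∅⊂σ = trans (cong₂ (λ x y → x ∧ not y) (∅⊆ σ) (trans (⊆∅ σ) (cong not e))) refl
  same : ∀ ρ → inTile (tile σ ∅ false) ρ ≡ inTile (tile σ ∅ true) ρ
  same ρ rewrite ≡ᵇ∅ ρ with nonempty ρ
  ... | true  = refl
  ... | false = refl

oddFaces⇒isCriticalTile : ∀ {n} (t : Tile n) → (crit t ≡ true → (low t ⊂ᵇ top t) ≡ true) →
  oddFaces (inTile t) ≡ true → isCriticalTile t ≡ true
oddFaces⇒isCriticalTile (tile σ τ true)  critIdx _   = isCriticalTile-intro (tile σ τ true) σ τ (critIdx refl) (λ _ → refl)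
oddFaces⇒isCriticalTile (tile σ τ false) _       odd
  with nonempty τ in ne | τ ≡ᵇ σ in τ≡ᵇσ | trans (sym (oddFaces-basic σ τ)) odd
... | true  | true  | _ rewrite ≡ᵇ⇒≡ τ σ τ≡ᵇσ = openSimplex-critical σ ne
... | false | false | _ rewrite empty⇒≡∅ τ ne =
  closedSimplex-critical σ (not-injective (trans (sym (∅≡ᵇ σ)) τ≡ᵇσ))

oddFaces-tile : ∀ {n} (t : Tile n) → (crit t ≡ true → (low t ⊂ᵇ top t) ≡ true) →
  oddFaces (inTile t) ≡ isCriticalTile t
oddFaces-tile t critIdx = ⇔→≡ (mk⇔ (oddFaces⇒isCriticalTile t critIdx) (isCriticalTile⇒oddFaces t))

-- Counting the pairs (face, tile containing it) in two ways.
oddFaces-tiling : ∀ S T → HTiling S T → oddFaces (inS S) ≡ isOdd (numCrit T)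
oddFaces-tiling S T H = begin
  oddFaces (inS S)
    ≡⟨ oddCount-cong (λ ρ → sym (tilesContaining ρ)) (allSubsets (N S)) ⟩
  oddFaces (λ ρ → oddCount (λ t → inTile t ρ) T)
    ≡⟨ oddCount-swap (λ ρ t → inTile t ρ) (allSubsets (N S)) T ⟩
  oddCount (λ t → oddFaces (inTile t)) T
    ≡⟨ oddCount-cong-All (All.map (λ {t} v → oddFaces-tile t (ValidTile.critIdx v)) (HTiling.valid H)) ⟩
  oddCount isCriticalTile T
    ≡⟨ sym (isOdd-countB isCriticalTile T) ⟩
  isOdd (numCrit T) ∎
  where
  open ≡-Reasoning
  isOdd-indicator : ∀ b → isOdd (if b then 1 else 0) ≡ b
  isOdd-indicator true  = refl
  isOdd-indicator false = refl
  tilesContaining : ∀ ρ → oddCount (λ t → inTile t ρ) T ≡ inS S ρ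
  tilesContaining ρ = trans (sym (isOdd-countB (λ t → inTile t ρ) T))
                            (trans (cong isOdd (HTiling.partition H ρ)) (isOdd-indicator (inS S ρ)))

size≤ : ∀ {n} (a : Simplex n) → size a ≤ n
size≤ []          = z≤n
size≤ (true ∷ a)  = s≤s (size≤ a)
size≤ (false ∷ a) = m≤n⇒m≤1+n (size≤ a)

⊆⇒size≤ : ∀ {n} (a b : Simplex n) → (a ⊆ᵇ b) ≡ true → size a ≤ size b
⊆⇒size≤ []          []          _ = z≤n
⊆⇒size≤ (true ∷ a)  (true ∷ b)  e = s≤s (⊆⇒size≤ a b e)
⊆⇒size≤ (false ∷ a) (true ∷ b)  e = m≤n⇒m≤1+n (⊆⇒size≤ a b e)
⊆⇒size≤ (false ∷ a) (false ∷ b) e = ⊆⇒size≤ a b e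

⊂⇒size< : ∀ {n} (a b : Simplex n) → (a ⊂ᵇ b) ≡ true → size a < size b
⊂⇒size< []          []          ()
⊂⇒size< (true ∷ a)  (true ∷ b)  e = s≤s (⊂⇒size< a b e)
⊂⇒size< (false ∷ a) (true ∷ b)  e = s≤s (⊆⇒size≤ a b (∧-conicalˡ (a ⊆ᵇ b) _ e))
⊂⇒size< (false ∷ a) (false ∷ b) e = ⊂⇒size< a b e

⊂-⊆-trans : ∀ {n} {a b c : Simplex n} → (a ⊂ᵇ b) ≡ true → (b ⊆ᵇ c) ≡ true → (a ⊂ᵇ c) ≡ true
⊂-⊆-trans {a = a} {b} {c} a⊂b b⊆c with c ⊆ᵇ a in c⊆a
... | false = cong (_∧ true) (⊆-trans {a = a} (∧-conicalˡ (a ⊆ᵇ b) _ a⊂b) b⊆c)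
... | true  with () ← trans (sym (∧-conicalʳ (a ⊆ᵇ b) _ a⊂b)) (cong not (⊆-trans {a = b} b⊆c c⊆a))

nonFacet-extends : ∀ {n} (Kc : Simplex n → Bool) a → Kc a ≡ true → isFacet Kc a ≡ false →
  ∃ λ τ → Kc τ ≡ true × (a ⊂ᵇ τ) ≡ true
nonFacet-extends {n} Kc a ka notFacet with any (λ τ → Kc τ ∧ (a ⊂ᵇ τ)) (allSubsets n) in ext
... | true  = let τ , e = any-witness _ (allSubsets n) ext in τ , ∧-conicalˡ (Kc τ) _ e , ∧-conicalʳ (Kc τ) _ e
... | false with () ← trans (sym (cong (_∧ true) ka)) notFacet

-- The fuel k bounds the codimension of a, since sizes grow along a chain of strict inclusions.
facetAbove : ∀ {n} (Kc : Simplex n → Bool) k a → n ≤ size a + k → Kc a ≡ true →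
  ∃ λ f → isFacet Kc f ≡ true × (a ⊆ᵇ f) ≡ true
facetAbove Kc k a bound ka with isFacet Kc a in isF
... | true  = a , isF , ⊆-refl a
... | false with nonFacet-extends Kc a ka isF
... | τ , kτ , a⊂τ with k
... | zero  = ⊥-elim (≤⇒≯ (subst (_ ≤_) (+-identityʳ (size a)) (≤-trans (size≤ τ) bound)) (⊂⇒size< a τ a⊂τ))
... | suc k with facetAbove Kc k τ (≤-trans bound (subst (_≤ size τ + k) (sym (+-suc (size a) k))
                                                          (+-monoˡ-≤ k (⊂⇒size< a τ a⊂τ)))) kτ
... | f , isFf , τ⊆f = f , isFf , ⊆-trans {a = a} (∧-conicalˡ (a ⊆ᵇ τ) _ a⊂τ) τ⊆f

strictFacetAbove : ∀ {n} (Kc : Simplex n → Bool) a → Kc a ≡ true → isFacet Kc a ≡ false →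
  ∃ λ f → isFacet Kc f ≡ true × (a ⊂ᵇ f) ≡ true
strictFacetAbove {n} Kc a ka notFacet with nonFacet-extends Kc a ka notFacet
... | τ , kτ , a⊂τ with facetAbove Kc n τ (m≤n+m n (size τ)) kτ
... | f , isFf , τ⊆f = f , isFf , ⊂-⊆-trans {a = a} {τ} a⊂τ τ⊆f

take-++ᵛ : ∀ {m n} (a : Simplex m) (b : Simplex n) → take m (a ++ᵛ b) ≡ a
take-++ᵛ []      b = refl
take-++ᵛ (x ∷ a) b = cong (x ∷_) (take-++ᵛ a b)

drop-++ᵛ : ∀ {m n} (a : Simplex m) (b : Simplex n) → drop m (a ++ᵛ b) ≡ b
drop-++ᵛ []      b = refl
drop-++ᵛ (x ∷ a) b = drop-++ᵛ a b

nonempty-++ᵛ : ∀ {m n} (a : Simplex m) (b : Simplex n) → nonempty (a ++ᵛ b) ≡ nonempty a ∨ nonempty b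
nonempty-++ᵛ []          b = refl
nonempty-++ᵛ (true ∷ a)  b = refl
nonempty-++ᵛ (false ∷ a) b = nonempty-++ᵛ a b

⊆-++ᵛ : ∀ {m n} (a c : Simplex m) (b d : Simplex n) → ((a ++ᵛ b) ⊆ᵇ (c ++ᵛ d)) ≡ (a ⊆ᵇ c) ∧ (b ⊆ᵇ d)
⊆-++ᵛ []      []      b d = refl
⊆-++ᵛ (x ∷ a) (y ∷ c) b d = trans (cong ((not x ∨ y) ∧_) (⊆-++ᵛ a c b d)) (sym (∧-assoc (not x ∨ y) _ _))

oddCount-allSubsets-+ : ∀ m n (f : Simplex (m + n) → Bool) →
  oddFaces f ≡ oddCount (λ a → oddCount (λ b → f (a ++ᵛ b)) (allSubsets n)) (allSubsets m)
oddCount-allSubsets-+ zero    n f = sym (xor-identityʳ _)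
oddCount-allSubsets-+ (suc m) n f =
  trans (oddCount-allSubsets-suc (m + n) f)
        (trans (cong₂ _xor_ (oddCount-allSubsets-+ m n (λ ρ → f (false ∷ ρ)))
                            (oddCount-allSubsets-+ m n (λ ρ → f (true ∷ ρ))))
               (sym (oddCount-allSubsets-suc m _)))

oddCount-allFin-suc : ∀ m (f : Fin (suc m) → Bool) →
  oddCount f (allFin (suc m)) ≡ f Fin.zero xor oddCount (λ j → f (Fin.suc j)) (allFin m)
oddCount-allFin-suc m f =
  cong (f Fin.zero xor_) (trans (cong (oddCount f) (sym (map-tabulate (λ j → j) Fin.suc)))
                                (oddCount-map f Fin.suc (allFin m)))

oddCount-lookup : ∀ (f : A → Bool) xs → oddCount (λ j → f (lookup xs j)) (allFin (length xs)) ≡ oddCount f xs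
oddCount-lookup f xs = trans (sym (oddCount-map f (lookup xs) (allFin (length xs))))
                             (cong (oddCount f) (trans (map-tabulate (λ j → j) (lookup xs)) (tabulate-lookup xs)))

oddCount-singletonIdx : ∀ m (h : Maybe (Fin m) → Bool) → h nothing ≡ false →
  oddFaces (λ b → h (singletonIdx b)) ≡ oddCount (λ j → h (just j)) (allFin m)
oddCount-singletonIdx zero    h h-nothing = cong (_xor false) h-nothing
oddCount-singletonIdx (suc m) h h-nothing = begin
  oddFaces (λ b → h (singletonIdx b))
    ≡⟨ oddCount-allSubsets-suc m _ ⟩
  oddFaces (λ b → h (Maybe.map Fin.suc (singletonIdx b))) xor oddFaces (λ b → h (singletonAt0 b))
    ≡⟨ cong₂ _xor_ (oddCount-singletonIdx m (λ x → h (Maybe.map Fin.suc x)) h-nothing)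
                   (trans (oddCount-cong onlyEmpty (allSubsets m)) (oddCount-empty m (h (just Fin.zero)))) ⟩
  oddCount (λ j → h (just (Fin.suc j))) (allFin m) xor h (just Fin.zero)
    ≡⟨ trans (xor-comm (oddCount (λ j → h (just (Fin.suc j))) (allFin m)) _)
             (sym (oddCount-allFin-suc m (λ j → h (just j)))) ⟩
  oddCount (λ j → h (just j)) (allFin (suc m)) ∎
  where
  open ≡-Reasoning
  singletonAt0 : Simplex m → Maybe (Fin (suc m))
  singletonAt0 b = if nonempty b then nothing else just Fin.zero
  onlyEmpty : ∀ b → h (singletonAt0 b) ≡ not (nonempty b) ∧ h (just Fin.zero)
  onlyEmpty b with nonempty b
  ... | true  = h-nothing
  ... | false = refl

-- New vertices of st S come after the old ones: a simplex of st S is a ++ᵛ b, with b ⊆ new vertices.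
K-st-cone : ∀ S a b j → singletonIdx b ≡ just j → K (st S) (a ++ᵛ b) ≡ (a ⊂ᵇ lookup (facetsList S) j)
K-st-cone S a b j b≡j =
  subst (λ x → K (st S) (a ++ᵛ b) ≡ (x ⊂ᵇ lookup (facetsList S) j)) (take-++ᵛ a b)
        (unfold (a ++ᵛ b) (trans (cong singletonIdx (drop-++ᵛ a b)) b≡j))
  where
  unfold : ∀ σ → singletonIdx (drop (N S) σ) ≡ just j → K (st S) σ ≡ (take (N S) σ ⊂ᵇ lookup (facetsList S) j)
  unfold σ e rewrite e = refl

K-st-old : ∀ S a b → singletonIdx b ≡ nothing →
  K (st S) (a ++ᵛ b) ≡ not (nonempty b) ∧ K S a ∧ not (isFacet (K S) a)
K-st-old S a b b≡∅ =
  subst₂ (λ x y → K (st S) (a ++ᵛ b) ≡ not (nonempty y) ∧ K S x ∧ not (isFacet (K S) x)) (take-++ᵛ a b) (drop-++ᵛ a b)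
         (unfold (a ++ᵛ b) (trans (cong singletonIdx (drop-++ᵛ a b)) b≡∅))
  where
  unfold : ∀ σ → singletonIdx (drop (N S) σ) ≡ nothing →
    K (st S) σ ≡ not (nonempty (drop (N S) σ)) ∧ K S (take (N S) σ) ∧ not (isFacet (K S) (take (N S) σ))
  unfold σ e rewrite e = refl

L-st : ∀ S a b → L (st S) (a ++ᵛ b) ≡ not (nonempty b) ∧ L S a
L-st S a b = cong₂ (λ x y → not (nonempty y) ∧ L S x) (take-++ᵛ a b) (drop-++ᵛ a b)

singletonIdx-just⇒nonempty : ∀ {n} (b : Simplex n) {j} → singletonIdx b ≡ just j → nonempty b ≡ true
singletonIdx-just⇒nonempty (true ∷ b)  _ = refl
singletonIdx-just⇒nonempty (false ∷ b) e with singletonIdx b in b≡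
singletonIdx-just⇒nonempty (false ∷ b) refl | just j = singletonIdx-just⇒nonempty b b≡

coneOver : (S : RelCx) → Simplex (N S) → Maybe (Fin (length (facetsList S))) → Bool
coneOver S a (just j) = a ⊂ᵇ lookup (facetsList S) j
coneOver S a nothing  = false

inS-st : ∀ S a b → inS (st S) (a ++ᵛ b)
  ≡ coneOver S a (singletonIdx b) xor (not (nonempty b) ∧ (inS S a ∧ not (isFacet (K S) a)))
inS-st S a b with singletonIdx b in b≡
... | just j  rewrite nonempty-++ᵛ a b | K-st-cone S a b j b≡ | L-st S a b | singletonIdx-just⇒nonempty b b≡
                    | ∨-zeroʳ (nonempty a) | ∧-identityʳ (a ⊂ᵇ lookup (facetsList S) j) = sym (xor-identityʳ _)
... | nothing rewrite nonempty-++ᵛ a b | K-st-old S a b b≡ | L-st S a b =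
  reorder (nonempty a) (nonempty b) (K S a) (isFacet (K S) a) (L S a)
  where
  reorder : ∀ x y k f l → (x ∨ y) ∧ ((not y ∧ (k ∧ not f)) ∧ not (not y ∧ l))
                          ≡ false xor (not y ∧ ((x ∧ (k ∧ not l)) ∧ not f))
  reorder false false k     f l = refl
  reorder true  false false f l = refl
  reorder true  false true  f l = ∧-comm (not f) (not l)
  reorder false true  k     f l = refl
  reorder true  true  k     f l = refl

LAvoidsFacets : RelCx → Set
LAvoidsFacets S = ∀ σ → isFacet (K S) σ ≡ true → L S σ ≡ false

-- Each facet σ is replaced by the cones over the 2^|σ| - 1 proper faces of σ: an odd number.
oddFaces-st : ∀ S → LAvoidsFacets S → oddFaces (inS (st S)) ≡ oddFaces (inS S)
oddFaces-st S avoids = begin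
  oddFaces (inS (st S))
    ≡⟨ oddCount-allSubsets-+ n F (inS (st S)) ⟩
  oddFaces (λ (a : Simplex n) → oddFaces (λ b → inS (st S) (a ++ᵛ b)))
    ≡⟨ oddCount-cong cones (allSubsets n) ⟩
  oddFaces (λ (a : Simplex n) → oddCount (λ j → a ⊂ᵇ lookup fl j) (allFin F) xor old a)
    ≡⟨ oddCount-xor _ old (allSubsets n) ⟩
  oddFaces (λ (a : Simplex n) → oddCount (λ j → a ⊂ᵇ lookup fl j) (allFin F)) xor oddFaces old
    ≡⟨ cong (_xor oddFaces old) facetCount ⟩
  oddFaces (λ (a : Simplex n) → isFacet (K S) a ∧ nonempty a) xor oddFaces old
    ≡⟨ sym (oddCount-xor _ old (allSubsets n)) ⟩
  oddFaces (λ (a : Simplex n) → (isFacet (K S) a ∧ nonempty a) xor old a)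
    ≡⟨ oddCount-cong (λ a → facetOrOld (isFacet (K S) a) (nonempty a) (K S a) (L S a)
                              (∧-conicalˡ (K S a) _) (avoids a)) (allSubsets n) ⟩
  oddFaces (inS S) ∎
  where
  open ≡-Reasoning
  n = N S
  fl = facetsList S
  F = length fl
  old : Simplex n → Bool
  old a = inS S a ∧ not (isFacet (K S) a)
  cones : ∀ a → oddFaces (λ b → inS (st S) (a ++ᵛ b)) ≡ oddCount (λ j → a ⊂ᵇ lookup fl j) (allFin F) xor old a
  cones a = trans (oddCount-cong (inS-st S a) (allSubsets F))
                  (trans (oddCount-xor (λ b → coneOver S a (singletonIdx b)) _ (allSubsets F))
                         (cong₂ _xor_ (oddCount-singletonIdx F (coneOver S a) refl) (oddCount-empty F (old a))))
  facetCount : oddFaces (λ (a : Simplex n) → oddCount (λ j → a ⊂ᵇ lookup fl j) (allFin F))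
             ≡ oddFaces (λ a → isFacet (K S) a ∧ nonempty a)
  facetCount = begin
    oddFaces (λ (a : Simplex n) → oddCount (λ j → a ⊂ᵇ lookup fl j) (allFin F))
      ≡⟨ oddCount-swap (λ a j → a ⊂ᵇ lookup fl j) (allSubsets n) (allFin F) ⟩
    oddCount (λ j → oddFaces (_⊂ᵇ lookup fl j)) (allFin F)
      ≡⟨ oddCount-cong (λ j → oddCount-⊂ᵇ n (lookup fl j)) (allFin F) ⟩
    oddCount (λ j → nonempty (lookup fl j)) (allFin F)
      ≡⟨ oddCount-lookup nonempty fl ⟩
    oddCount nonempty fl
      ≡⟨ oddCount-filterB (isFacet (K S)) nonempty (allSubsets n) ⟩
    oddFaces (λ (a : Simplex n) → isFacet (K S) a ∧ nonempty a) ∎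
  facetOrOld : ∀ f e k l → (f ≡ true → k ≡ true) → (f ≡ true → l ≡ false) →
               (f ∧ e) xor ((e ∧ (k ∧ not l)) ∧ not f) ≡ e ∧ (k ∧ not l)
  facetOrOld true  e k l k≡ l≡ rewrite k≡ refl | l≡ refl =
    trans (cong (e xor_) (∧-zeroʳ _)) (trans (xor-identityʳ e) (sym (∧-identityʳ e)))
  facetOrOld false e k l _  _  = ∧-identityʳ _

vertex : ∀ {m} → Fin m → Simplex m
vertex Fin.zero    = true ∷ ∅
vertex (Fin.suc j) = false ∷ vertex j

nonempty-vertex : ∀ {m} (j : Fin m) → nonempty (vertex j) ≡ true
nonempty-vertex Fin.zero    = refl
nonempty-vertex (Fin.suc j) = nonempty-vertex j

singletonIdx-vertex : ∀ {m} (j : Fin m) → singletonIdx (vertex j) ≡ just j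
singletonIdx-vertex {suc m} Fin.zero rewrite nonempty-∅ {m} = refl
singletonIdx-vertex (Fin.suc j) rewrite singletonIdx-vertex j = refl

singletonIdx-∅ : ∀ {m} → singletonIdx (∅ {m}) ≡ nothing
singletonIdx-∅ {zero}  = refl
singletonIdx-∅ {suc m} rewrite singletonIdx-∅ {m} = refl

∈-filterB : ∀ (p : A → Bool) {x} xs → p x ≡ true → x ∈ xs → x ∈ filterB p xs
∈-filterB p (y ∷ xs) px x∈ with p y in py
∈-filterB p (y ∷ xs) px (here refl)  | true  = here refl
∈-filterB p (y ∷ xs) px (there x∈)   | true  = there (∈-filterB p xs px x∈)
∈-filterB p (y ∷ xs) px (here refl)  | false with () ← trans (sym px) py
∈-filterB p (y ∷ xs) px (there x∈)   | false = ∈-filterB p xs px x∈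

facetIndex : ∀ S f → isFacet (K S) f ≡ true → ∃ λ j → lookup (facetsList S) j ≡ f
facetIndex S f isF = Any.index f∈ , sym (lookup-index f∈)
  where f∈ = ∈-filterB (isFacet (K S)) (allSubsets (N S)) isF (∈-allSubsets f)

∅⊂-++ᵛ : ∀ {m n} (a : Simplex m) (b : Simplex n) → nonempty b ≡ true → ((a ++ᵛ ∅) ⊂ᵇ (a ++ᵛ b)) ≡ true
∅⊂-++ᵛ a b ne rewrite ⊆-++ᵛ a a ∅ b | ⊆-++ᵛ a a b ∅ | ⊆-refl a | ∅⊆ b | ⊆∅ b | ne = refl

-- A non-facet a of K lies in some facet f_j, so a ++ᵛ ∅ lies in the cone a ++ᵛ {f̂_j}.
old-notFacet-st : ∀ S a → isFacet (K (st S)) (a ++ᵛ ∅ {length (facetsList S)}) ≡ false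
old-notFacet-st S a with K (st S) (a ++ᵛ ∅) in k
... | false = refl
... | true  = cong not (any-intro (λ τ → K (st S) τ ∧ ((a ++ᵛ ∅) ⊂ᵇ τ)) (∈-allSubsets (a ++ᵛ vertex j))
                                 (cong₂ _∧_ coneInK oldInCone))
  where
  nonFacet : K S a ∧ not (isFacet (K S) a) ≡ true
  nonFacet = trans (sym (trans (K-st-old S a ∅ singletonIdx-∅)
                               (cong (λ x → not x ∧ (K S a ∧ not (isFacet (K S) a))) (nonempty-∅ {length (facetsList S)}))))
                   k
  above = strictFacetAbove (K S) a (∧-conicalˡ (K S a) _ nonFacet)
            (trans (sym (not-involutive _)) (cong not (∧-conicalʳ (K S a) _ nonFacet)))
  f = proj₁ above
  index = facetIndex S f (proj₁ (proj₂ above))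
  j = proj₁ index
  coneInK : K (st S) (a ++ᵛ vertex j) ≡ true
  coneInK = trans (K-st-cone S a (vertex j) j (singletonIdx-vertex j))
                  (subst (λ x → (a ⊂ᵇ x) ≡ true) (sym (proj₂ index)) (proj₂ (proj₂ above)))
  oldInCone : ((a ++ᵛ ∅) ⊂ᵇ (a ++ᵛ vertex j)) ≡ true
  oldInCone = ∅⊂-++ᵛ a (vertex j) (nonempty-vertex j)

st-avoidsFacets : ∀ S → LAvoidsFacets (st S)
st-avoidsFacets S σ isF with nonempty (drop (N S) σ) in ne
... | true  = refl
... | false = case trans (sym isF) (subst (λ x → isFacet (K (st S)) x ≡ false) oldσ (old-notFacet-st S (take (N S) σ)))
              of λ ()
  where
  oldσ : take (N S) σ ++ᵛ ∅ ≡ σ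
  oldσ = trans (cong (take (N S) σ ++ᵛ_) (sym (empty⇒≡∅ _ ne))) (take++drop≡id (N S) σ)

infix 4 _≡₂_
record _≡₂_ (x y : ℤ) : Set where
  constructor even-diff
  field 2∣x-y : + 2 ∣ (x - y)
open _≡₂_

≡₂-refl : ∀ x → x ≡₂ x
≡₂-refl x = even-diff (divides (+ 0) (x-x≡0 x))
  where
  x-x≡0 : ∀ x → x - x ≡ + 0 * + 2
  x-x≡0 = solve-∀

≡₂-trans : ∀ {x y z} → x ≡₂ y → y ≡₂ z → x ≡₂ z
≡₂-trans {x} {y} {z} x≡y y≡z = even-diff (subst (+ 2 ∣_) (telescope x y z) (∣m∣n⇒∣m+n (2∣x-y x≡y) (2∣x-y y≡z)))
  where
  telescope : ∀ x y z → (x - y) +ℤ (y - z) ≡ x - z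
  telescope = solve-∀

≡₂-sym : ∀ {x y} → x ≡₂ y → y ≡₂ x
≡₂-sym {x} {y} x≡y = even-diff (subst (+ 2 ∣_) (negate x y) (∣m⇒∣-m (2∣x-y x≡y)))
  where
  negate : ∀ x y → - (x - y) ≡ y - x
  negate = solve-∀

≡₂-+ : ∀ {a b c d} → a ≡₂ b → c ≡₂ d → a +ℤ c ≡₂ b +ℤ d
≡₂-+ {a} {b} {c} {d} a≡b c≡d = even-diff (subst (+ 2 ∣_) (interchange a b c d) (∣m∣n⇒∣m+n (2∣x-y a≡b) (2∣x-y c≡d)))
  where
  interchange : ∀ a b c d → (a - b) +ℤ (c - d) ≡ (a +ℤ c) - (b +ℤ d)
  interchange = solve-∀

neg-≡₂ : ∀ x → - x ≡₂ x
neg-≡₂ x = even-diff (subst (+ 2 ∣_) (double x) (∣m⇒∣-m (∣m⇒∣m*n x (∣-refl {+ 2}))))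
  where
  double : ∀ x → - (+ 2 * x) ≡ - x - x
  double = solve-∀

2≡₂0 : + 2 ≡₂ + 0
2≡₂0 = even-diff (divides (+ 1) refl)

+-≡₂-isOdd : ∀ m → + m ≡₂ + (if isOdd m then 1 else 0)
+-≡₂-isOdd zero    = ≡₂-refl (+ 0)
+-≡₂-isOdd (suc m) = ≡₂-trans (≡₂-+ (≡₂-refl (+ 1)) (+-≡₂-isOdd m)) (carry (isOdd m))
  where
  carry : ∀ b → + 1 +ℤ + (if b then 1 else 0) ≡₂ + (if not b then 1 else 0)
  carry true  = 2≡₂0
  carry false = ≡₂-refl (+ 1)

isOdd-≡₂ : ∀ m n → isOdd m ≡ isOdd n → + m ≡₂ + n
isOdd-≡₂ m n m≡n = ≡₂-trans (+-≡₂-isOdd m) (subst (λ b → + (if b then 1 else 0) ≡₂ + n) (sym m≡n) (≡₂-sym (+-≡₂-isOdd n)))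

sgnDim-≡₂ : ∀ k → sgnDim (suc k) ≡₂ + 1
sgnDim-≡₂ zero    = ≡₂-refl (+ 1)
sgnDim-≡₂ (suc k) = ≡₂-trans (neg-≡₂ (alt k)) (sgnDim-≡₂ k)

sgnDim-size-≡₂ : ∀ {n} (ρ : Simplex n) → nonempty ρ ≡ true → sgnDim (size ρ) ≡₂ + 1
sgnDim-size-≡₂ (true ∷ ρ)  _ = sgnDim-≡₂ (size ρ)
sgnDim-size-≡₂ (false ∷ ρ) e = sgnDim-size-≡₂ ρ e

-- Mod 2 every sign (-1)^dim ρ is 1.
signedSum-≡₂ : ∀ {n} (p : Simplex n → Bool) → (∀ ρ → p ρ ≡ true → nonempty ρ ≡ true) → ∀ xs →
  sumℤ (map (λ ρ → if p ρ then sgnDim (size ρ) else + 0) xs) ≡₂ + countB p xs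
signedSum-≡₂ p p⇒nonempty [] = ≡₂-refl (+ 0)
signedSum-≡₂ p p⇒nonempty (x ∷ xs) with p x in px
... | true  = ≡₂-+ (sgnDim-size-≡₂ x (p⇒nonempty x px)) (signedSum-≡₂ p p⇒nonempty xs)
... | false = subst (_≡₂ + countB p xs) (sym (+-identityˡ _)) (signedSum-≡₂ p p⇒nonempty xs)

chi-≡₂ : ∀ S → chi S ≡₂ + countB (inS S) (allSubsets (N S))
chi-≡₂ S = signedSum-≡₂ (inS S) (λ ρ e → ∧-conicalˡ (nonempty ρ) _ e) (allSubsets (N S))

parityEq-chi : ∀ S m → isOdd m ≡ oddFaces (inS S) → ParityEq m (chi S)
parityEq-chi S m m≡faces = ∣⇒∣ᵤ (2∣x-y (≡₂-trans (isOdd-≡₂ m _ m≡count) (≡₂-sym (chi-≡₂ S))))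
  where m≡count = trans m≡faces (sym (isOdd-countB (inS S) (allSubsets (N S))))

stIter-avoidsFacets : ∀ d S → IsRelComplex S → LAvoidsFacets (stIter d S)
stIter-avoidsFacets zero    S R = IsRelComplex.L-nofacet R
stIter-avoidsFacets (suc d) S R = st-avoidsFacets (stIter d S)

oddFaces-stIter : ∀ d S → IsRelComplex S → oddFaces (inS (stIter d S)) ≡ oddFaces (inS S)
oddFaces-stIter zero    S R = refl
oddFaces-stIter (suc d) S R = trans (oddFaces-st (stIter d S) (stIter-avoidsFacets d S R)) (oddFaces-stIter d S R)

numCrit-parityEq : ∀ S T → HTiling S T → ParityEq (numCrit T) (chi S)
numCrit-parityEq S T H = parityEq-chi S (numCrit T) (sym (oddFaces-tiling S T H))

lemma5p6 : (S : RelCx) → IsRelComplex S →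
    (∀ m → IsMuInf S m → ParityEq m (chi S))
    × ((Σ (List (Tile (N S))) λ T → HTiling S T) → ∀ m → IsMuPrime S m → ParityEq m (chi S))
    × ((Σ (List (Tile (N S))) λ T → ShellableHTiling S T) → ∀ m → IsMu S m → ParityEq m (chi S))
lemma5p6 S R = muInf , muPrime , mu
  where
  muInf : ∀ m → IsMuInf S m → ParityEq m (chi S)
  muInf _ ((d , T , shellable , refl) , _) =
    parityEq-chi S (numCrit T)
      (trans (sym (oddFaces-tiling _ T (ShellableHTiling.htiling shellable))) (oddFaces-stIter d S R))
  muPrime : (Σ (List (Tile (N S))) λ T → HTiling S T) → ∀ m → IsMuPrime S m → ParityEq m (chi S)
  muPrime _ _ ((T , H , refl) , _) = numCrit-parityEq S T H
  mu : (Σ (List (Tile (N S))) λ T → ShellableHTiling S T) → ∀ m → IsMu S m → ParityEq m (chi S)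
  mu _ _ ((T , shellable , refl) , _) = numCrit-parityEq S T (ShellableHTiling.htiling shellable)
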